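{- Let $H$ be a circle graph with directed chords such that $\omega(H)\geq 7$. Then there are pairwise different points $a,b,c,d,x,y,z,u$ appearing in clockwise order on the circle such that $(a,x),(b,y),(c,z),(d,u)$ are pairwise crossing chords of $H$.
   Context: A chord is a pair of distinct points on a circle; a directed chord $(p,q)$ is an ordered pair with tail $p$ and head $q$. Two chords with endpoints $\{p,p'\}$ and $\{q,q'\}$ cross if their endpoints are all distinct and $p,q,p',q'$ occur in this order on the circle (clockwise or counterclockwise). A circle graph with directed chords is a graph whose vertices are directed chords of a circle, two being adjacent iff they cross. $\omega(H)$ denotes the maximum size of a clique of $H$. -}

module Defs where

open import Data.Nat using (ℕ; _<_)
open import Data.Product using (_×_; _,_; ∃; proj₁; proj₂)
open import Relation.Binary.PropositionalEquality using (_≢_)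
open import Data.Sum using (_⊎_)
open import Data.List using (List; []; _∷_; drop; take; _++_; reverse)
open import Data.List.Relation.Unary.All using (All)
open import Data.List.Relation.Unary.AllPairs using (AllPairs)
open import Data.List.Membership.Propositional using (_∈_)

-- Points of the circle: a finite set of points on a circle is modelled by
-- natural numbers, the clockwise order being the increasing order of ℕ read
-- cyclically (i.e. the circle is cut at some point not among the endpoints).
Point : Set
Point = ℕ

Chord : Set
Chord = Point × Point

Clockwise : List Point → Set
Clockwise ps = ∃ λ k → AllPairs _<_ (drop k ps ++ take k ps)

Crosses : Chord → Chord → Set
Crosses (p , p') (q , q') =
  Clockwise (p ∷ q ∷ p' ∷ q' ∷ []) ⊎ Clockwise (reverse (p ∷ q ∷ p' ∷ q' ∷ []))

-- A circle graph with directed chords: given by its (finite) list of chords,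
-- each with two distinct endpoints; vertices are the chords, adjacency = crossing.
ValidChords : List Chord → Set
ValidChords H = All (λ c → proj₁ c ≢ proj₂ c) H

IsClique : List Chord → List Chord → Set
IsClique H K = All (_∈ H) K × AllPairs Crosses K

-- Orient every chord of the clique from its smaller to its larger endpoint.
-- Among 7 chords at least 4 get the same orientation. Two crossing chords
-- oriented this way interleave, p < q < p' < q', and interleaving has no
-- 3-cycles (the tails would decrease around it), so the chords of one
-- orientation can be sorted into a chain in which every earlier chord
-- interleaves every later one. The first four chords of that chain,
-- t₁ < t₂ < t₃ < t₄ < h₁ < h₂ < h₃ < h₄, are the required configuration,
-- read from the tails when they were forward and from the heads otherwise.
module Submission where

open import Defs
open import Data.Nat using (_≤_; _<_; s≤s; suc; _+_)
open import Data.Nat.Properties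
  using (<-asym; <-trans; _<?_; ≮⇒≥; ≤∧≢⇒<; +-suc; +-cancelˡ-<; +-monoˡ-≤; <-≤-trans)
open import Data.Product using (_×_; _,_; ∃; ∃₂; proj₁; proj₂; swap)
open import Data.Sum using (_⊎_; inj₁; inj₂)
open import Data.Empty using (⊥-elim)
open import Function using (_∘_)
open import Relation.Nullary using (¬_; yes; no)
open import Relation.Unary using (Pred; Decidable)
open import Relation.Unary.Properties using (∁?)
open import Relation.Binary using (Rel)
open import Relation.Binary.PropositionalEquality using (_≡_; _≢_; refl; cong; trans; sym; subst)
open import Data.List using (List; []; _∷_; length; filter; map)
open import Data.List.Properties using (length-map)
open import Data.List.Relation.Unary.All as All using (All; []; _∷_)
open import Data.List.Relation.Unary.All.Properties using (all-filter; filter⁺; map⁺)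
open import Data.List.Relation.Unary.AllPairs as AllPairs using (AllPairs; []; _∷_)
import Data.List.Relation.Unary.AllPairs.Properties as AllPairs
open import Data.List.Relation.Unary.Linked using ([-]; _∷_)
open import Data.List.Relation.Unary.Linked.Properties using (Linked⇒AllPairs)
open import Data.List.Relation.Binary.Permutation.Propositional as ↭ using (_↭_; ↭-sym)
open import Data.List.Relation.Binary.Permutation.Propositional.Properties using (All-resp-↭; ↭-length)

m+n<o+p⇒m<o⊎n<p : ∀ m n {o p} → m + n < o + p → m < o ⊎ n < p
m+n<o+p⇒m<o⊎n<p m n {o} {p} m+n<o+p with m <? o
... | yes m<o = inj₁ m<o
... | no m≮o  = inj₂ (+-cancelˡ-< m n p (<-≤-trans m+n<o+p (+-monoˡ-≤ p (≮⇒≥ m≮o))))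

module _ {a p} {A : Set a} {P : Pred A p} (P? : Decidable P) where

  length-filter+length-filter-∁ : ∀ xs →
    length (filter P? xs) + length (filter (∁? P?) xs) ≡ length xs
  length-filter+length-filter-∁ []       = refl
  length-filter+length-filter-∁ (x ∷ xs) with P? x
  ... | yes _ = cong suc (length-filter+length-filter-∁ xs)
  ... | no _  = trans (+-suc _ _) (cong suc (length-filter+length-filter-∁ xs))

module _ {a r} {A : Set a} {R : Rel A r}
         (acyclic₃ : ∀ {x y z} → R x y → R y z → ¬ R z x) where

  private
    Comparable : Rel A r
    Comparable x y = R x y ⊎ R y x

    comparable-trans : ∀ {x y z} → R x y → R y z → Comparable x z → R x z
    comparable-trans _   _   (inj₁ Rxz) = Rxz
    comparable-trans Rxy Ryz (inj₂ Rzx) = ⊥-elim (acyclic₃ Rxy Ryz Rzx)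

  insert-sorted : ∀ x {ys} → All (Comparable x) ys → AllPairs R ys →
    ∃ λ zs → zs ↭ x ∷ ys × AllPairs R zs
  insert-sorted x {[]} [] [] = x ∷ [] , ↭.refl , [] ∷ []
  insert-sorted x {y ∷ ys} (inj₁ Rxy ∷ x~ys) (Ry ∷ sorted) =
    x ∷ y ∷ ys , ↭.refl ,
    (Rxy ∷ All.zipWith (λ (Ryz , x~z) → comparable-trans Rxy Ryz x~z) (Ry , x~ys)) ∷ Ry ∷ sorted
  insert-sorted x {y ∷ ys} (inj₂ Ryx ∷ x~ys) (Ry ∷ sorted)
    with zs , zs↭x∷ys , sorted-zs ← insert-sorted x x~ys sorted =
    y ∷ zs , ↭.trans (↭.prep y zs↭x∷ys) (↭.swap y x ↭.refl) ,
    All-resp-↭ (↭-sym zs↭x∷ys) (Ryx ∷ Ry) ∷ sorted-zs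

  sort-comparable : ∀ {xs} → AllPairs Comparable xs → ∃ λ ys → ys ↭ xs × AllPairs R ys
  sort-comparable {[]} [] = [] , ↭.refl , []
  sort-comparable {x ∷ xs} (x~xs ∷ comparable)
    with ys , ys↭xs , sorted ← sort-comparable comparable
    with zs , zs↭x∷ys , sorted-zs ← insert-sorted x (All-resp-↭ (↭-sym ys↭xs) x~xs) sorted =
    zs , ↭.trans zs↭x∷ys (↭.prep x ys↭xs) , sorted-zs

Forward : Chord → Set
Forward (p , q) = p < q

forward? : Decidable Forward
forward? (p , q) = p <? q

Interleaved : Rel Chord _
Interleaved (p , p') (q , q') = p < q × q < p' × p' < q'

backward⇒forward-swap : ∀ {c} → ¬ Forward c → proj₁ c ≢ proj₂ c → Forward (swap c)
backward⇒forward-swap p≮q p≢q = ≤∧≢⇒< (≮⇒≥ p≮q) (p≢q ∘ sym)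

interleaved-acyclic₃ : ∀ {c d e} → Interleaved c d → Interleaved d e → ¬ Interleaved e c
interleaved-acyclic₃ (tc<td , _) (td<te , _) (te<tc , _) = <-asym te<tc (<-trans tc<td td<te)

-- Rotating by k ≥ 4 leaves a 4-point list unchanged, but `drop` only
-- computes once k is split past 4.
clockwise-rotate₂ : ∀ {w x y z} →
  Clockwise (w ∷ x ∷ y ∷ z ∷ []) → Clockwise (y ∷ z ∷ w ∷ x ∷ [])
clockwise-rotate₂ (0 , ascending)                         = 2 , ascending
clockwise-rotate₂ (1 , ascending)                         = 3 , ascending
clockwise-rotate₂ (2 , ascending)                         = 0 , ascending
clockwise-rotate₂ (3 , ascending)                         = 1 , ascending
clockwise-rotate₂ (4 , ascending)                         = 2 , ascending
clockwise-rotate₂ (suc (suc (suc (suc (suc _)))) , ascending) = 2 , ascending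

crosses-swap : ∀ {c d} → Crosses c d → Crosses (swap c) (swap d)
crosses-swap (inj₁ clockwise)        = inj₁ (clockwise-rotate₂ clockwise)
crosses-swap (inj₂ counterclockwise) = inj₂ (clockwise-rotate₂ counterclockwise)

interleaved⇒crosses : ∀ {c d} → Interleaved c d → Crosses c d
interleaved⇒crosses (p<q , q<p' , p'<q') =
  inj₁ (0 , Linked⇒AllPairs <-trans (p<q ∷ q<p' ∷ p'<q' ∷ [-]))

-- Every cyclic rotation other than the expected one puts a head before its
-- own tail.
forward-crosses⇒interleaved : ∀ {c d} → Forward c → Forward d → Crosses c d →
  Interleaved c d ⊎ Interleaved d c
forward-crosses⇒interleaved _ _ (inj₁ (0 , (p<q ∷ _) ∷ (q<p' ∷ _) ∷ (p'<q' ∷ _) ∷ _)) =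
  inj₁ (p<q , q<p' , p'<q')
forward-crosses⇒interleaved p<p' _ (inj₁ (1 , _ ∷ (_ ∷ p'<p ∷ _) ∷ _)) = ⊥-elim (<-asym p<p' p'<p)
forward-crosses⇒interleaved p<p' _ (inj₁ (2 , (_ ∷ p'<p ∷ _) ∷ _))     = ⊥-elim (<-asym p<p' p'<p)
forward-crosses⇒interleaved _ q<q' (inj₁ (3 , (_ ∷ q'<q ∷ _) ∷ _))     = ⊥-elim (<-asym q<q' q'<q)
forward-crosses⇒interleaved _ _ (inj₁ (4 , (p<q ∷ _) ∷ (q<p' ∷ _) ∷ (p'<q' ∷ _) ∷ _)) =
  inj₁ (p<q , q<p' , p'<q')
forward-crosses⇒interleaved _ _
  (inj₁ (suc (suc (suc (suc (suc _)))) , (p<q ∷ _) ∷ (q<p' ∷ _) ∷ (p'<q' ∷ _) ∷ _)) =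
  inj₁ (p<q , q<p' , p'<q')
forward-crosses⇒interleaved _ q<q' (inj₂ (0 , (_ ∷ q'<q ∷ _) ∷ _))     = ⊥-elim (<-asym q<q' q'<q)
forward-crosses⇒interleaved p<p' _ (inj₂ (1 , (_ ∷ p'<p ∷ _) ∷ _))     = ⊥-elim (<-asym p<p' p'<p)
forward-crosses⇒interleaved _ _ (inj₂ (2 , (q<p ∷ _) ∷ (p<q' ∷ _) ∷ (q'<p' ∷ _) ∷ _)) =
  inj₂ (q<p , p<q' , q'<p')
forward-crosses⇒interleaved _ q<q' (inj₂ (3 , _ ∷ (_ ∷ q'<q ∷ _) ∷ _)) = ⊥-elim (<-asym q<q' q'<q)
forward-crosses⇒interleaved _ q<q' (inj₂ (4 , (_ ∷ q'<q ∷ _) ∷ _))     = ⊥-elim (<-asym q<q' q'<q)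
forward-crosses⇒interleaved _ q<q'
  (inj₂ (suc (suc (suc (suc (suc _)))) , (_ ∷ q'<q ∷ _) ∷ _)) = ⊥-elim (<-asym q<q' q'<q)

forward-clique⇒comparable : ∀ {cs} → All Forward cs → AllPairs Crosses cs →
  AllPairs (λ c d → Interleaved c d ⊎ Interleaved d c) cs
forward-clique⇒comparable [] [] = []
forward-clique⇒comparable (c→ ∷ cs→) (c×cs ∷ clique) =
  All.zipWith (λ (d→ , c×d) → forward-crosses⇒interleaved c→ d→ c×d) (cs→ , c×cs)
  ∷ forward-clique⇒comparable cs→ clique

Quadruple : Pred Chord _ → Set
Quadruple Q = ∃₂ λ c₁ c₂ → ∃₂ λ c₃ c₄ →
  All Q (c₁ ∷ c₂ ∷ c₃ ∷ c₄ ∷ []) × AllPairs Interleaved (c₁ ∷ c₂ ∷ c₃ ∷ c₄ ∷ [])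

interleaved-quadruple⇒ascending : ∀ {t₁ h₁ t₂ h₂ t₃ h₃ t₄ h₄} →
  AllPairs Interleaved ((t₁ , h₁) ∷ (t₂ , h₂) ∷ (t₃ , h₃) ∷ (t₄ , h₄) ∷ []) →
  AllPairs _<_ (t₁ ∷ t₂ ∷ t₃ ∷ t₄ ∷ h₁ ∷ h₂ ∷ h₃ ∷ h₄ ∷ [])
interleaved-quadruple⇒ascending
  ( ((t₁<t₂ , _ , h₁<h₂) ∷ _ ∷ (_ , t₄<h₁ , _) ∷ [])
  ∷ ((t₂<t₃ , _ , h₂<h₃) ∷ _)
  ∷ ((t₃<t₄ , _ , h₃<h₄) ∷ _)
  ∷ _) =
  Linked⇒AllPairs <-trans (t₁<t₂ ∷ t₂<t₃ ∷ t₃<t₄ ∷ t₄<h₁ ∷ h₁<h₂ ∷ h₂<h₃ ∷ h₃<h₄ ∷ [-])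

initial-quadruple : ∀ {Q} cs → All Q cs → AllPairs Interleaved cs → 4 ≤ length cs → Quadruple Q
initial-quadruple (c₁ ∷ c₂ ∷ c₃ ∷ c₄ ∷ _) (Qc₁ ∷ Qc₂ ∷ Qc₃ ∷ Qc₄ ∷ _) chain _ =
  c₁ , c₂ , c₃ , c₄ , Qc₁ ∷ Qc₂ ∷ Qc₃ ∷ Qc₄ ∷ [] , AllPairs.take⁺ 4 chain
initial-quadruple (_ ∷ _ ∷ _ ∷ []) _ _ (s≤s (s≤s (s≤s ())))
initial-quadruple (_ ∷ _ ∷ [])     _ _ (s≤s (s≤s ()))
initial-quadruple (_ ∷ [])         _ _ (s≤s ())
initial-quadruple []               _ _ ()

forward-clique⇒quadruple : ∀ {Q} cs → All Q cs → All Forward cs → AllPairs Crosses cs →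
  4 ≤ length cs → Quadruple Q
forward-clique⇒quadruple cs Qcs cs→ clique 4≤|cs|
  with sorted , sorted↭cs , chain ←
         sort-comparable interleaved-acyclic₃ (forward-clique⇒comparable cs→ clique) =
  initial-quadruple sorted (All-resp-↭ (↭-sym sorted↭cs) Qcs) chain
    (subst (4 ≤_) (sym (↭-length sorted↭cs)) 4≤|cs|)

clique⇒quadruple : ∀ {Q} K → All Q K → All (λ c → proj₁ c ≢ proj₂ c) K → AllPairs Crosses K →
  7 ≤ length K → Quadruple Q ⊎ Quadruple (Q ∘ swap)
clique⇒quadruple K QK distinct clique 7≤|K|
  with m+n<o+p⇒m<o⊎n<p 3 3 (subst (7 ≤_) (sym (length-filter+length-filter-∁ forward? K)) 7≤|K|)
... | inj₁ 4≤|F| = inj₁ (forward-clique⇒quadruple (filter forward? K)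
  (filter⁺ forward? QK) (all-filter forward? K) (AllPairs.filter⁺ forward? clique) 4≤|F|)
... | inj₂ 4≤|B| = inj₂ (forward-clique⇒quadruple (map swap B)
  (map⁺ (filter⁺ (∁? forward?) QK))
  (map⁺ (All.zipWith (λ (c↚ , p≢q) → backward⇒forward-swap c↚ p≢q)
    (all-filter (∁? forward?) K , filter⁺ (∁? forward?) distinct)))
  (AllPairs.map⁺ (AllPairs.map crosses-swap (AllPairs.filter⁺ (∁? forward?) clique)))
  (subst (4 ≤_) (sym (length-map swap B)) 4≤|B|))
  where B = filter (∁? forward?) K

lemma10 : (H : List Chord) → ValidChords H →
    (∃ λ K → IsClique H K × 7 ≤ length K) →
    ∃ λ a → ∃ λ b → ∃ λ c → ∃ λ d → ∃ λ x → ∃ λ y → ∃ λ z → ∃ λ u →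
    Clockwise (a ∷ b ∷ c ∷ d ∷ x ∷ y ∷ z ∷ u ∷ []) ×
    IsClique H ((a , x) ∷ (b , y) ∷ (c , z) ∷ (d , u) ∷ [])
lemma10 H valid (K , (K⊆H , clique) , 7≤|K|)
  with clique⇒quadruple K K⊆H (All.map (All.lookup valid) K⊆H) clique 7≤|K|
... | inj₁ ((t₁ , h₁) , (t₂ , h₂) , (t₃ , h₃) , (t₄ , h₄) , ∈H , chain) =
  t₁ , t₂ , t₃ , t₄ , h₁ , h₂ , h₃ , h₄ , (0 , interleaved-quadruple⇒ascending chain) ,
  ∈H , AllPairs.map interleaved⇒crosses chain
... | inj₂ ((t₁ , h₁) , (t₂ , h₂) , (t₃ , h₃) , (t₄ , h₄) , ∈H , chain) =
  h₁ , h₂ , h₃ , h₄ , t₁ , t₂ , t₃ , t₄ , (4 , interleaved-quadruple⇒ascending chain) ,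
  map⁺ ∈H , AllPairs.map⁺ (AllPairs.map (crosses-swap ∘ interleaved⇒crosses) chain)
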